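{- Let $H$ be an instance as described in the context and let $\ell_p$ be the maximum length of a program's preference list. Let $\mathcal{B}'=\{p^*_a : a\in\mathcal{A}\}$ and let $M$ match every agent $a$ to its most-preferred program among those in $\mathcal{B}'$ on its preference list. Then the total cost $\sum_{p\in\mathcal{B}}|M(p)|c(p)$ is at most $\ell_p$ times the minimum total cost of an $\mathcal{A}$-perfect stable matching in $H$.
   Context: An instance consists of a bipartite graph $(\mathcal{A}\cup\mathcal{B},E)$, agents $\mathcal{A}$, programs $\mathcal{B}$, $(a,p)\in E$ iff mutually acceptable; every agent has a non-empty preference list. Each agent and each program ranks its neighbours in a strict order ($y>_x z$: $x$ prefers $y$ to $z$). Each program $p$ has a non-negative integer cost $c(p)$; programs have no quotas. A matching $M\subseteq E$ assigns each agent to at most one program (a program may receive any number of agents); $M(a)$, $M(p)$ denote partners. An agent prefers any acceptable program to being unmatched. A pair $(a,p)\in E\setminus M$ blocks $M$ if $p>_a M(a)$ and there is $a'\in M(p)$ with $a>_p a'$; $M$ is stable if no pair blocks it; $M$ is $\mathcal{A}$-perfect if every agent is matched. For an agent $a$, $p^*_a$ is the program of minimum cost on $a$'s preference list, ties broken in favour of the program $a$ prefers most. -}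

module Defs where

open import Data.Nat using (ℕ; _+_; _*_; _<_; _≤_; _⊔_)
open import Data.Fin using (Fin; _≟_)
open import Data.Bool using (Bool; true; false; if_then_else_)
open import Data.Maybe using (Maybe; just; nothing)
open import Data.List using (List; map; foldr; allFin)
open import Data.Nat.ListAction using (sum)
open import Data.Unit using (⊤)
open import Data.Product using (Σ; ∃; _×_; _,_)
open import Data.Sum using (_⊎_)
open import Relation.Nullary using (¬_; does)
open import Relation.Binary.PropositionalEquality using (_≡_; _≢_)

-- Strict preferences are given by ranks: smaller rank = more preferred;
-- ranks are injective on each vertex's neighbourhood (strict order).
record Instance : Set where
  field
    nA nB : ℕ
    E     : Fin nA → Fin nB → Bool
    rankA : Fin nA → Fin nB → ℕ
    rankB : Fin nB → Fin nA → ℕ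
    cost  : Fin nB → ℕ
    rankA-inj : ∀ a p q → E a p ≡ true → E a q ≡ true → rankA a p ≡ rankA a q → p ≡ q
    rankB-inj : ∀ p a b → E a p ≡ true → E b p ≡ true → rankB p a ≡ rankB p b → a ≡ b
    nonempty  : ∀ a → Σ (Fin nB) λ p → E a p ≡ true

module _ (H : Instance) where
  open Instance H

  _≻[_]_ : Fin nB → Fin nA → Fin nB → Set
  p ≻[ a ] q = rankA a p < rankA a q

  _≻ᵖ[_]_ : Fin nA → Fin nB → Fin nA → Set
  a ≻ᵖ[ p ] b = rankB p a < rankB p b

  -- A matching: each agent assigned to at most one program, along edges;
  -- programs have no quotas.
  Matching : Set
  Matching = Σ (Fin nA → Maybe (Fin nB)) λ M → ∀ a p → M a ≡ just p → E a p ≡ true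

  PrefersOver : Fin nA → Fin nB → Maybe (Fin nB) → Set
  PrefersOver a p nothing  = ⊤
  PrefersOver a p (just q) = p ≻[ a ] q

  Blocks : Matching → Fin nA → Fin nB → Set
  Blocks (M , _) a p =
    E a p ≡ true × M a ≢ just p × PrefersOver a p (M a) ×
    Σ (Fin nA) λ a' → M a' ≡ just p × a ≻ᵖ[ p ] a'

  Stable : Matching → Set
  Stable M = ∀ a p → ¬ Blocks M a p

  APerfect : Matching → Set
  APerfect (M , _) = ∀ a → Σ (Fin nB) λ p → M a ≡ just p

  assignedTo : Maybe (Fin nB) → Fin nB → ℕ
  assignedTo nothing  p = 0
  assignedTo (just q) p = if does (q ≟ p) then 1 else 0

  load : (Fin nA → Maybe (Fin nB)) → Fin nB → ℕ
  load M p = sum (map (λ a → assignedTo (M a) p) (allFin nA))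

  totalCost : (Fin nA → Maybe (Fin nB)) → ℕ
  totalCost M = sum (map (λ p → load M p * cost p) (allFin nB))

  degB : Fin nB → ℕ
  degB p = sum (map (λ a → if E a p then 1 else 0) (allFin nA))

  ℓp : ℕ
  ℓp = foldr _⊔_ 0 (map degB (allFin nB))

  IsPStar : Fin nA → Fin nB → Set
  IsPStar a p = E a p ≡ true ×
    (∀ q → E a q ≡ true → cost p < cost q ⊎ (cost p ≡ cost q × rankA a p ≤ rankA a q))

  InB' : Fin nB → Set
  InB' p = Σ (Fin nA) λ a → IsPStar a p

  IsBPrimeMatching : (Fin nA → Fin nB) → Set
  IsBPrimeMatching M = ∀ a →
    E a (M a) ≡ true × InB' (M a) ×
    (∀ q → E a q ≡ true → InB' q → rankA a (M a) ≤ rankA a q)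

-- Each agent a is matched by M to p*_b for some agent b = w a, and c(p*_b) ≤ c(N(b)) because
-- p*_b has minimum cost on b's list and N is A-perfect; hence cost(M) ≤ Σ_a c(N(w a)).
-- Each b is w a for at most ℓ_p agents a: p*_b is determined by b, so every such a has p*_b on
-- its list and therefore lies on the preference list of p*_b.
module Submission where

open import Defs
open import Data.Nat using (ℕ; _*_; _≤_)
open import Data.Fin using (Fin)
open import Data.Maybe using (Maybe; just)
open import Data.Product using (_,_; proj₁)

open import Data.Nat using (suc; _+_; _⊔_; z≤n)
open import Data.Nat.Properties
  using (module ≤-Reasoning; +-mono-≤; +-identityʳ; *-zeroʳ; *-distribˡ-+; *-distribʳ-+; *-monoˡ-≤;
         ≤-refl; ≤-trans; ≤-reflexive; ≤-antisym; <⇒≤; <-asym; <-irrefl; m≤m⊔n; m≤n⊔m; +-commutativeSemigroup)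
open import Algebra.Properties.CommutativeSemigroup +-commutativeSemigroup
  using () renaming (interchange to +-interchange)
open import Data.Nat.ListAction using (sum)
open import Data.Fin using (_≟_; zero; suc)
open import Data.Fin.Properties using (any?)
open import Data.Bool using (true; if_then_else_)
open import Data.List using (List; []; _∷_; map; foldr; allFin)
open import Data.List.Properties using (map-tabulate; map-cong)
open import Data.List.Membership.Propositional using (_∈_)
open import Data.List.Membership.Propositional.Properties using (∈-allFin; ∈-map⁺)
open import Data.List.Relation.Unary.Any using (here; there)
open import Data.Product using (proj₂)
open import Data.Sum using (inj₁; inj₂)
open import Data.Empty using (⊥-elim)
open import Function using (_∘_)
open import Relation.Nullary using (does; yes; no)
open import Relation.Binary.PropositionalEquality
  using (_≡_; refl; sym; trans; cong; cong₂; subst; module ≡-Reasoning)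

module _ {A : Set} where

  sum-map-mono : ∀ {f g : A → ℕ} xs → (∀ x → f x ≤ g x) → sum (map f xs) ≤ sum (map g xs)
  sum-map-mono []       f≤g = z≤n
  sum-map-mono (x ∷ xs) f≤g = +-mono-≤ (f≤g x) (sum-map-mono xs f≤g)

  sum-map-zero : ∀ (xs : List A) → sum (map (λ _ → 0) xs) ≡ 0
  sum-map-zero []       = refl
  sum-map-zero (_ ∷ xs) = sum-map-zero xs

  sum-map-+ : ∀ (f g : A → ℕ) xs →
              sum (map (λ x → f x + g x) xs) ≡ sum (map f xs) + sum (map g xs)
  sum-map-+ f g []       = refl
  sum-map-+ f g (x ∷ xs) = begin
    f x + g x + sum (map (λ x → f x + g x) xs)
      ≡⟨ cong (f x + g x +_) (sum-map-+ f g xs) ⟩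
    f x + g x + (sum (map f xs) + sum (map g xs))
      ≡⟨ +-interchange (f x) (g x) _ _ ⟩
    f x + sum (map f xs) + (g x + sum (map g xs)) ∎
    where open ≡-Reasoning

  sum-map-*ˡ : ∀ k (f : A → ℕ) xs → sum (map (λ x → k * f x) xs) ≡ k * sum (map f xs)
  sum-map-*ˡ k f []       = sym (*-zeroʳ k)
  sum-map-*ˡ k f (x ∷ xs) =
    trans (cong (k * f x +_) (sum-map-*ˡ k f xs)) (sym (*-distribˡ-+ k (f x) _))

sum-map-allFin-suc : ∀ {n} (g : Fin (suc n) → ℕ) →
                     sum (map g (allFin (suc n))) ≡ g zero + sum (map (g ∘ suc) (allFin n))
sum-map-allFin-suc g =
  cong (λ xs → g zero + sum xs) (trans (map-tabulate suc g) (sym (map-tabulate (λ p → p) (g ∘ suc))))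

∈⇒≤foldr-⊔ : ∀ {n ns} → n ∈ ns → n ≤ foldr _⊔_ 0 ns
∈⇒≤foldr-⊔ (here refl)  = m≤m⊔n _ _
∈⇒≤foldr-⊔ (there n∈ns) = ≤-trans (∈⇒≤foldr-⊔ n∈ns) (m≤n⊔m _ _)

indicator : ∀ {n} → Fin n → Fin n → ℕ
indicator q p = if does (q ≟ p) then 1 else 0

sum-indicator-* : ∀ {n} (y : Fin n) (c : Fin n → ℕ) →
                  sum (map (λ p → indicator y p * c p) (allFin n)) ≡ c y
sum-indicator-* {suc n} zero c = begin
  sum (map (λ p → indicator zero p * c p) (allFin (suc n)))
    ≡⟨ sum-map-allFin-suc (λ p → indicator zero p * c p) ⟩
  c zero + 0 + sum (map (λ _ → 0) (allFin n))
    ≡⟨ cong (c zero + 0 +_) (sum-map-zero (allFin n)) ⟩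
  c zero + 0 + 0
    ≡⟨ trans (+-identityʳ _) (+-identityʳ _) ⟩
  c zero ∎
  where open ≡-Reasoning
sum-indicator-* (suc y) c =
  trans (sum-map-allFin-suc (λ p → indicator (suc y) p * c p)) (sum-indicator-* y (c ∘ suc))

fibreSize : ∀ {A : Set} {n} → (A → Fin n) → List A → Fin n → ℕ
fibreSize f as p = sum (map (λ a → indicator (f a) p) as)

sum-fibreSize-* : ∀ {A : Set} {n} (f : A → Fin n) (c : Fin n → ℕ) as →
                  sum (map (λ p → fibreSize f as p * c p) (allFin n)) ≡ sum (map (c ∘ f) as)
sum-fibreSize-* {n = n} f c [] = sum-map-zero (allFin n)
sum-fibreSize-* {n = n} f c (a ∷ as) = begin
  sum (map (λ p → (indicator (f a) p + fibreSize f as p) * c p) (allFin n))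
    ≡⟨ cong sum (map-cong (λ p → *-distribʳ-+ (c p) (indicator (f a) p) _) (allFin n)) ⟩
  sum (map (λ p → indicator (f a) p * c p + fibreSize f as p * c p) (allFin n))
    ≡⟨ sum-map-+ _ _ (allFin n) ⟩
  sum (map (λ p → indicator (f a) p * c p) (allFin n)) + sum (map (λ p → fibreSize f as p * c p) (allFin n))
    ≡⟨ cong₂ _+_ (sum-indicator-* (f a) c) (sum-fibreSize-* f c as) ⟩
  c (f a) + sum (map (c ∘ f) as) ∎
  where open ≡-Reasoning

module _ (H : Instance) where
  open Instance H

  IsPStar-unique : ∀ {a p q} → IsPStar H a p → IsPStar H a q → p ≡ q
  IsPStar-unique {a} {p} {q} (Eap , p-min) (Eaq , q-min) with p-min q Eaq | q-min p Eap
  ... | inj₁ cp<cq      | inj₁ cq<cp      = ⊥-elim (<-asym cp<cq cq<cp)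
  ... | inj₁ cp<cq      | inj₂ (cq≡cp , _) = ⊥-elim (<-irrefl (sym cq≡cp) cp<cq)
  ... | inj₂ (cp≡cq , _) | inj₁ cq<cp      = ⊥-elim (<-irrefl (sym cp≡cq) cq<cp)
  ... | inj₂ (_ , rp≤rq) | inj₂ (_ , rq≤rp) = rankA-inj a p q Eap Eaq (≤-antisym rp≤rq rq≤rp)

  IsPStar-cost-≤ : ∀ {a p q} → IsPStar H a p → E a q ≡ true → cost p ≤ cost q
  IsPStar-cost-≤ {q = q} (_ , p-min) Eaq with p-min q Eaq
  ... | inj₁ cp<cq      = <⇒≤ cp<cq
  ... | inj₂ (cp≡cq , _) = ≤-reflexive cp≡cq

  degB≤ℓp : ∀ p → degB H p ≤ ℓp H
  degB≤ℓp p = ∈⇒≤foldr-⊔ (∈-map⁺ (degB H) (∈-allFin p))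

  totalCost-just : (f : Fin nA → Fin nB) → totalCost H (just ∘ f) ≡ sum (map (cost ∘ f) (allFin nA))
  totalCost-just f = sum-fibreSize-* f cost (allFin nA)

  totalCost-cong : ∀ {M M′ : Fin nA → Maybe (Fin nB)} → (∀ a → M a ≡ M′ a) → totalCost H M ≡ totalCost H M′
  totalCost-cong {M} {M′} M≗M′ = cong sum (map-cong (λ p → cong (_* cost p) (load-cong p)) (allFin nB))
    where
    load-cong : ∀ p → load H M p ≡ load H M′ p
    load-cong p = cong sum (map-cong (λ a → cong (λ m → assignedTo H m p) (M≗M′ a)) (allFin nA))

  module BPrimeMatching (M : Fin nA → Fin nB) (M-B′ : IsBPrimeMatching H M) where

    witness : Fin nA → Fin nA
    witness a = proj₁ (proj₁ (proj₂ (M-B′ a)))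

    M-pstar : ∀ a → IsPStar H (witness a) (M a)
    M-pstar a = proj₂ (proj₁ (proj₂ (M-B′ a)))

    M-acceptable : ∀ a → E a (M a) ≡ true
    M-acceptable a = proj₁ (M-B′ a)

    same-witness⇒acceptable : ∀ {a a′} → witness a ≡ witness a′ → E a (M a′) ≡ true
    same-witness⇒acceptable {a} {a′} w≡w′ = subst (λ q → E a q ≡ true) M≡M′ (M-acceptable a)
      where
      M≡M′ : M a ≡ M a′
      M≡M′ = IsPStar-unique (subst (λ b → IsPStar H b (M a)) w≡w′ (M-pstar a)) (M-pstar a′)

    fibreSize-witness≤ℓp : ∀ b → fibreSize witness (allFin nA) b ≤ ℓp H
    fibreSize-witness≤ℓp b with any? (λ a → witness a ≟ b)
    ... | yes (a₀ , w₀≡b) =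
      ≤-trans (sum-map-mono (allFin nA) on-list-of-M₀) (degB≤ℓp (M a₀))
      where
      on-list-of-M₀ : ∀ a → indicator (witness a) b ≤ (if E a (M a₀) then 1 else 0)
      on-list-of-M₀ a with witness a ≟ b
      ... | no _ = z≤n
      ... | yes w≡b rewrite same-witness⇒acceptable {a} (trans w≡b (sym w₀≡b)) = ≤-refl
    ... | no nobody =
      ≤-trans (sum-map-mono (allFin nA) outside-fibre) (≤-trans (≤-reflexive (sum-map-zero (allFin nA))) z≤n)
      where
      outside-fibre : ∀ a → indicator (witness a) b ≤ 0
      outside-fibre a with witness a ≟ b
      ... | yes w≡b = ⊥-elim (nobody (a , w≡b))
      ... | no _ = z≤n

lemma7 : (H : Instance) → (M : Fin (Instance.nA H) → Fin (Instance.nB H)) →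
    IsBPrimeMatching H M →
    (N : Matching H) → APerfect H N → Stable H N →
    totalCost H (λ a → just (M a)) ≤ ℓp H * totalCost H (proj₁ N)
lemma7 H M M-B′ (N , N-acceptable) N-perfect _ = begin
  totalCost H (just ∘ M)                                         ≡⟨ totalCost-just H M ⟩
  sum (map (cost ∘ M) (allFin nA))                               ≤⟨ sum-map-mono (allFin nA) M≤N∘witness ⟩
  sum (map (cost ∘ N′ ∘ witness) (allFin nA))                    ≡⟨ sum-fibreSize-* witness (cost ∘ N′) (allFin nA) ⟨
  sum (map (λ b → fibreSize witness (allFin nA) b * cost (N′ b)) (allFin nA))
    ≤⟨ sum-map-mono (allFin nA) (λ b → *-monoˡ-≤ (cost (N′ b)) (fibreSize-witness≤ℓp b)) ⟩
  sum (map (λ b → ℓp H * cost (N′ b)) (allFin nA))               ≡⟨ sum-map-*ˡ (ℓp H) (cost ∘ N′) (allFin nA) ⟩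
  ℓp H * sum (map (cost ∘ N′) (allFin nA))                       ≡⟨ cong (ℓp H *_) (totalCost-just H N′) ⟨
  ℓp H * totalCost H (just ∘ N′)                                 ≡⟨ cong (ℓp H *_) (totalCost-cong H N≗N′) ⟨
  ℓp H * totalCost H N                                           ∎
  where
  open Instance H
  open BPrimeMatching H M M-B′
  open ≤-Reasoning

  N′ : Fin nA → Fin nB
  N′ a = proj₁ (N-perfect a)

  N≗N′ : ∀ a → N a ≡ just (N′ a)
  N≗N′ a = proj₂ (N-perfect a)

  M≤N∘witness : ∀ a → cost (M a) ≤ cost (N′ (witness a))
  M≤N∘witness a = IsPStar-cost-≤ H (M-pstar a) (N-acceptable (witness a) (N′ (witness a)) (N≗N′ (witness a)))
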